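{- Let $n\ge1$, $A\in\mathrm{Int}(n)$ and $x=\Gamma(A)=(x_1,\dots,x_n)$. Then the number of positive entries of $A$ equals $n-|\{i\in[2,n]:x_i=x_{i-1}\}|$.
   Context: $\mathrm{Int}(n)$ is the set of upper triangular square matrices with non-negative integer entries summing to $n$ such that every row and column has a non-zero entry. For such $A$: $\dim(A)$ is the number of rows, $\mathrm{index}(A)$ the smallest $i$ with $A_{i,\dim(A)}>0$, $\mathrm{val}(A)=A_{\mathrm{index}(A),\dim(A)}$. For a sequence $y$, $\mathrm{asc}(y)$ is the number of $i$ with $y_i<y_{i+1}$; $\mathrm{Asc}(n)$ is the set of integer sequences $(x_1,\dots,x_n)$ with $x_1=0$ and $x_i\in[0,1+\mathrm{asc}(x_1,\dots,x_{i-1})]$ for $1<i\le n$. Removal operation $f$ on $A\in\mathrm{Int}(n)$, $n\ge2$: (Rem1) if $\mathrm{val}(A)>1$, or if $\mathrm{val}(A)=1$, $\mathrm{index}(A)<\dim(A)$ and row $\mathrm{index}(A)$ has another positive entry, decrease entry $(\mathrm{index}(A),\dim(A))$ by $1$; (Rem2) if $\mathrm{val}(A)=1$ and $\mathrm{index}(A)=\dim(A)$, delete last row and column; (Rem3) if $\mathrm{val}(A)=1$, $\mathrm{index}(A)<\dim(A)$ and all other entries of row $\mathrm{index}(A)$ are $0$, set $A_{i,\dim(A)}:=A_{i,\mathrm{index}(A)}$ for $1\le i\le\mathrm{index}(A)-1$, then delete row and column $\mathrm{index}(A)$. $\Gamma:\mathrm{Int}(n)\to\mathrm{Asc}(n)$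 (a bijection): $\Gamma((1))=(0)$ and for $n\ge2$, $\Gamma(A)$ is $\Gamma(f(A))$ with $\mathrm{index}(A)-1$ appended. -}

module Defs where

open import Data.Nat using (ℕ; zero; suc; _+_; _∸_; _≤_; _<_; _≡ᵇ_; _<ᵇ_)
open import Data.Bool using (Bool; true; false; if_then_else_; _∧_)
open import Data.List using (List; []; _∷_; _++_)
open import Data.Product using (Σ; _×_; ∃-syntax)
open import Relation.Binary.PropositionalEquality using (_≡_)

-- A square matrix of dimension `dim`, entries indexed 1-based by natural
-- numbers: the meaningful entries are `ent i j` with 1 ≤ i, j ≤ dim
-- (values outside this range are irrelevant and never inspected by the
-- definitions below except as harmless junk).
record Mat : Set where
  constructor mat
  field
    dim : ℕ
    ent : ℕ → ℕ → ℕ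
open Mat public

sumTo : ℕ → (ℕ → ℕ) → ℕ
sumTo zero    g = 0
sumTo (suc d) g = sumTo d g + g (suc d)

pos : ℕ → ℕ
pos zero    = 0
pos (suc _) = 1

total : Mat → ℕ
total A = sumTo (dim A) (λ i → sumTo (dim A) (λ j → ent A i j))

numPositive : Mat → ℕ
numPositive A = sumTo (dim A) (λ i → sumTo (dim A) (λ j → pos (ent A i j)))

IsInt : ℕ → Mat → Set
IsInt n A =
  (∀ i j → 1 ≤ j → j < i → i ≤ dim A → ent A i j ≡ 0)
  × total A ≡ n
  × (∀ i → 1 ≤ i → i ≤ dim A →
       ∃[ j ] (1 ≤ j × j ≤ dim A × 0 < ent A i j))
  × (∀ j → 1 ≤ j → j ≤ dim A →
       ∃[ i ] (1 ≤ i × i ≤ dim A × 0 < ent A i j))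

-- smallest i ≥ start (checking k candidates) with g i > 0; junk default otherwise
firstPosFrom : (ℕ → ℕ) → ℕ → ℕ → ℕ
firstPosFrom g zero    i = i
firstPosFrom g (suc k) i = if 0 <ᵇ g i then i else firstPosFrom g k (suc i)

index : Mat → ℕ
index A = firstPosFrom (λ i → ent A i (dim A)) (dim A) 1

val : Mat → ℕ
val A = ent A (index A) (dim A)

otherPosInRow : Mat → ℕ
otherPosInRow A = sumTo (dim A ∸ 1) (λ j → pos (ent A (index A) j))

rem1 : Mat → Mat
rem1 A = mat (dim A) (λ i j →
  if (i ≡ᵇ index A) ∧ (j ≡ᵇ dim A) then ent A i j ∸ 1 else ent A i j)

rem2 : Mat → Mat
rem2 A = mat (dim A ∸ 1) (ent A)

skip : ℕ → ℕ → ℕ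
skip k i = if i <ᵇ k then i else suc i

-- (Rem3): copy column index(A) into column dim A for rows 1..index(A)-1,
-- then delete row and column index(A)
rem3 : Mat → Mat
rem3 A = mat (dim A ∸ 1) (λ i j → e1 (skip k i) (skip k j))
  where
  k = index A
  e1 : ℕ → ℕ → ℕ
  e1 i j = if (j ≡ᵇ dim A) ∧ (0 <ᵇ i) ∧ (i <ᵇ k) then ent A i k else ent A i j

removal : Mat → Mat
removal A with val A
... | zero = A                      -- impossible for A ∈ Int(n)
... | suc (suc _) = rem1 A
... | suc zero =
  if index A <ᵇ dim A
  then (if 0 <ᵇ otherPosInRow A then rem1 A else rem3 A)
  else rem2 A

Γ : ℕ → Mat → List ℕ
Γ zero          A = []
Γ (suc zero)    A = 0 ∷ []
Γ (suc (suc m)) A = Γ (suc m) (removal A) ++ ((index A ∸ 1) ∷ [])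

adjEq : List ℕ → ℕ
adjEq (x ∷ y ∷ r) = (if x ≡ᵇ y then 1 else 0) + adjEq (y ∷ r)
adjEq _           = 0

-- A removal step f either lowers the positive entry A(index A, dim A) without
-- killing it, which changes neither index A nor the set of positive entries, or
-- it destroys exactly one positive entry (Rem1 with val 1, Rem2, Rem3), and then
-- index (f A) ≠ index A.  The last two letters of Γ A are index (f A) − 1 and
-- index A − 1, so every step contributes either one adjacent equality or one
-- positive entry, never both: numPositive A + adjEq (Γ n A) = n by induction.
module Submission where

open import Defs
open import Data.Nat using (ℕ; _≤_; _∸_)
open import Relation.Binary.PropositionalEquality using (_≡_)
open import Data.Bool using (true; false; T; if_then_else_; _∧_)
open import Data.Bool.Properties using (∧-zeroʳ)
open import Data.Empty using (⊥-elim)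
open import Data.List using ([]; _∷_; _++_)
open import Data.Nat
open import Data.Nat.Properties
open import Algebra.Properties.CommutativeSemigroup +-commutativeSemigroup
  using (xy∙z≈xz∙y; x∙yz≈xz∙y)
open import Data.Product using (_×_; _,_; proj₁; proj₂; ∃-syntax)
open import Data.Sum using (_⊎_; inj₁; inj₂)
open import Data.Unit using (tt)
open import Function using (id)
open import Relation.Binary.Definitions using (tri<; tri≈; tri>)
open import Relation.Binary.PropositionalEquality
open import Relation.Nullary using (yes; no)

≡ᵇ-refl : ∀ m → (m ≡ᵇ m) ≡ true
≡ᵇ-refl zero    = refl
≡ᵇ-refl (suc m) = ≡ᵇ-refl m

≡ᵇ≡true⇒≡ : ∀ {m n} → (m ≡ᵇ n) ≡ true → m ≡ n
≡ᵇ≡true⇒≡ {m} {n} eq = ≡ᵇ⇒≡ m n (subst T (sym eq) tt)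

≢⇒≡ᵇ≡false : ∀ {m n} → m ≢ n → (m ≡ᵇ n) ≡ false
≢⇒≡ᵇ≡false {m} {n} m≢n with m ≡ᵇ n in eq
... | false = refl
... | true  = ⊥-elim (m≢n (≡ᵇ≡true⇒≡ eq))

<ᵇ≡true⇒< : ∀ {m n} → (m <ᵇ n) ≡ true → m < n
<ᵇ≡true⇒< {m} {n} eq = <ᵇ⇒< m n (subst T (sym eq) tt)

<ᵇ≡false⇒≥ : ∀ {m n} → (m <ᵇ n) ≡ false → n ≤ m
<ᵇ≡false⇒≥ eq = ≮⇒≥ (λ m<n → subst T eq (<⇒<ᵇ m<n))

<⇒<ᵇ≡true : ∀ {m n} → m < n → (m <ᵇ n) ≡ true
<⇒<ᵇ≡true {m} {n} m<n with m <ᵇ n | <⇒<ᵇ m<n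
... | true | _ = refl

≥⇒<ᵇ≡false : ∀ {m n} → n ≤ m → (m <ᵇ n) ≡ false
≥⇒<ᵇ≡false {m} {n} n≤m with m <ᵇ n in eq
... | false = refl
... | true  = ⊥-elim (<⇒≱ (<ᵇ≡true⇒< eq) n≤m)

≤∸1⇒< : ∀ {i} d → 1 ≤ i → i ≤ d ∸ 1 → i < d
≤∸1⇒< zero    (s≤s _) ()
≤∸1⇒< (suc d) _ i≤d = s≤s i≤d

<⇒≤∸1 : ∀ {i d} → i < d → i ≤ d ∸ 1
<⇒≤∸1 {d = suc d} (s≤s i≤d) = i≤d

suc[d∸1]≡d : ∀ {d} → 1 ≤ d → suc (d ∸ 1) ≡ d
suc[d∸1]≡d {suc d} _ = refl

∸1-injective : ∀ {m n} → 1 ≤ m → 1 ≤ n → m ∸ 1 ≡ n ∸ 1 → m ≡ n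
∸1-injective (s≤s _) (s≤s _) eq = cong suc eq

x+v≡y+[v∸1]⇒1+x≡y : ∀ {x y v} → 0 < v → x + v ≡ y + (v ∸ 1) → suc x ≡ y
x+v≡y+[v∸1]⇒1+x≡y {x} {v = suc w} _ eq = +-cancelʳ-≡ w _ _ (trans (sym (+-suc x w)) eq)

pos-positive : ∀ {x} → 0 < x → pos x ≡ 1
pos-positive {suc _} _ = refl

pos>0⇒>0 : ∀ {x} → 0 < pos x → 0 < x
pos>0⇒>0 {suc _} _ = z<s

pos≡0⇒≡0 : ∀ {x} → pos x ≡ 0 → x ≡ 0
pos≡0⇒≡0 {zero} _ = refl

-- Finite sums

sumTo-cong : ∀ d {f g : ℕ → ℕ} → (∀ i → 1 ≤ i → i ≤ d → f i ≡ g i) →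
  sumTo d f ≡ sumTo d g
sumTo-cong zero    f≗g = refl
sumTo-cong (suc d) f≗g = cong₂ _+_
  (sumTo-cong d (λ i 1≤i i≤d → f≗g i 1≤i (m≤n⇒m≤1+n i≤d)))
  (f≗g (suc d) (s≤s z≤n) ≤-refl)

sumTo-zero : ∀ d {f : ℕ → ℕ} → (∀ i → 1 ≤ i → i ≤ d → f i ≡ 0) → sumTo d f ≡ 0
sumTo-zero zero    f≗0 = refl
sumTo-zero (suc d) f≗0 = cong₂ _+_
  (sumTo-zero d (λ i 1≤i i≤d → f≗0 i 1≤i (m≤n⇒m≤1+n i≤d)))
  (f≗0 (suc d) (s≤s z≤n) ≤-refl)

term≤sumTo : ∀ d (f : ℕ → ℕ) {i} → 1 ≤ i → i ≤ d → f i ≤ sumTo d f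
term≤sumTo zero    f (s≤s _) ()
term≤sumTo (suc d) f 1≤i i≤1+d with m≤n⇒m<n∨m≡n i≤1+d
... | inj₁ i<1+d = ≤-trans (term≤sumTo d f 1≤i (≤-pred i<1+d)) (m≤m+n _ _)
... | inj₂ refl  = m≤n+m _ _

sumTo≡0⇒term≡0 : ∀ d (f : ℕ → ℕ) {i} → sumTo d f ≡ 0 → 1 ≤ i → i ≤ d → f i ≡ 0
sumTo≡0⇒term≡0 d f eq 1≤i i≤d = n≤0⇒n≡0 (subst (f _ ≤_) eq (term≤sumTo d f 1≤i i≤d))

d≤sumTo : ∀ d (f : ℕ → ℕ) → (∀ i → 1 ≤ i → i ≤ d → 1 ≤ f i) → d ≤ sumTo d f
d≤sumTo zero    f f≥1 = z≤n
d≤sumTo (suc d) f f≥1 = ≤-trans (≤-reflexive (+-comm 1 d))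
  (+-mono-≤ (d≤sumTo d f (λ i 1≤i i≤d → f≥1 i 1≤i (m≤n⇒m≤1+n i≤d)))
            (f≥1 (suc d) (s≤s z≤n) ≤-refl))

∃-positive-term : ∀ d (f : ℕ → ℕ) → 0 < sumTo d f → ∃[ i ] (1 ≤ i × i ≤ d × 0 < f i)
∃-positive-term (suc d) f sum>0 with f (suc d) in eq
... | suc _ = suc d , s≤s z≤n , ≤-refl , subst (0 <_) (sym eq) z<s
... | zero with ∃-positive-term d f (subst (0 <_) (+-identityʳ _) sum>0)
...   | i , 1≤i , i≤d , fi>0 = i , 1≤i , m≤n⇒m≤1+n i≤d , fi>0

sumTo-single : ∀ d {p} (f : ℕ → ℕ) → 1 ≤ p → p ≤ d →
  (∀ i → 1 ≤ i → i ≤ d → i ≢ p → f i ≡ 0) → sumTo d f ≡ f p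
sumTo-single zero    f (s≤s _) ()
sumTo-single (suc d) f 1≤p p≤1+d f≗0 with m≤n⇒m<n∨m≡n p≤1+d
... | inj₂ refl = cong (_+ f (suc d))
  (sumTo-zero d (λ i 1≤i i≤d → f≗0 i 1≤i (m≤n⇒m≤1+n i≤d) (<⇒≢ (s≤s i≤d))))
... | inj₁ p<1+d = trans
  (cong₂ _+_ (sumTo-single d f 1≤p (≤-pred p<1+d) (λ i 1≤i i≤d → f≗0 i 1≤i (m≤n⇒m≤1+n i≤d)))
             (f≗0 (suc d) (s≤s z≤n) ≤-refl (>⇒≢ p<1+d)))
  (+-identityʳ _)

sumTo-update : ∀ d {p} (f g : ℕ → ℕ) → 1 ≤ p → p ≤ d →
  (∀ i → 1 ≤ i → i ≤ d → i ≢ p → g i ≡ f i) → sumTo d g + f p ≡ sumTo d f + g p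
sumTo-update zero    f g (s≤s _) ()
sumTo-update (suc d) {p} f g 1≤p p≤1+d g≗f with m≤n⇒m<n∨m≡n p≤1+d
... | inj₂ refl = trans (xy∙z≈xz∙y (sumTo d g) _ _) (cong (λ s → s + f (suc d) + g (suc d))
  (sumTo-cong d (λ i 1≤i i≤d → g≗f i 1≤i (m≤n⇒m≤1+n i≤d) (<⇒≢ (s≤s i≤d)))))
... | inj₁ p<1+d = begin
  sumTo d g + g (suc d) + f p  ≡⟨ xy∙z≈xz∙y (sumTo d g) _ _ ⟩
  sumTo d g + f p + g (suc d)  ≡⟨ cong₂ _+_ previous (g≗f (suc d) (s≤s z≤n) ≤-refl (>⇒≢ p<1+d)) ⟩
  sumTo d f + g p + f (suc d)  ≡⟨ xy∙z≈xz∙y (sumTo d f) _ _ ⟩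
  sumTo d f + f (suc d) + g p  ∎
  where
  open ≡-Reasoning
  previous : sumTo d g + f p ≡ sumTo d f + g p
  previous = sumTo-update d f g 1≤p (≤-pred p<1+d) (λ i 1≤i i≤d → g≗f i 1≤i (m≤n⇒m≤1+n i≤d))

skip-< : ∀ {k i} → i < k → skip k i ≡ i
skip-< i<k rewrite <⇒<ᵇ≡true i<k = refl

skip-≥ : ∀ {k i} → k ≤ i → skip k i ≡ suc i
skip-≥ k≤i rewrite ≥⇒<ᵇ≡false k≤i = refl

skip-cases : ∀ k i → (i < k × skip k i ≡ i) ⊎ (k ≤ i × skip k i ≡ suc i)
skip-cases k i with i <? k
... | yes i<k = inj₁ (i<k , skip-< i<k)
... | no  i≮k = inj₂ (≮⇒≥ i≮k , skip-≥ (≮⇒≥ i≮k))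

skip-≢ : ∀ k i → skip k i ≢ k
skip-≢ k i with skip-cases k i
... | inj₁ (i<k , eq) = λ s≡k → <⇒≢ i<k (trans (sym eq) s≡k)
... | inj₂ (k≤i , eq) = λ s≡k → <⇒≢ (s≤s k≤i) (trans (sym s≡k) eq)

skip-inRange : ∀ k d {i} → 1 ≤ i → i ≤ d ∸ 1 → 1 ≤ skip k i × skip k i ≤ d
skip-inRange k d {i} 1≤i i≤d∸1 with skip-cases k i
... | inj₁ (_ , eq) rewrite eq = 1≤i , <⇒≤ (≤∸1⇒< d 1≤i i≤d∸1)
... | inj₂ (_ , eq) rewrite eq = s≤s z≤n , ≤∸1⇒< d 1≤i i≤d∸1

skip-<-mono : ∀ k {i j} → j < i → skip k j < skip k i
skip-<-mono k {i} {j} j<i with skip-cases k i | skip-cases k j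
... | inj₁ (_ , ei) | inj₁ (_ , ej) rewrite ei | ej = j<i
... | inj₂ (_ , ei) | inj₁ (_ , ej) rewrite ei | ej = m<n⇒m<1+n j<i
... | inj₂ (_ , ei) | inj₂ (_ , ej) rewrite ei | ej = s≤s j<i
... | inj₁ (i<k , _) | inj₂ (k≤j , _) = ⊥-elim (n≮n k (≤-<-trans k≤j (<-trans j<i i<k)))

skip-surjective : ∀ {k d i′} → 1 ≤ k → k ≤ d → 1 ≤ i′ → i′ ≤ d → i′ ≢ k →
  ∃[ i ] (1 ≤ i × i ≤ d ∸ 1 × skip k i ≡ i′)
skip-surjective {k} {d} {suc i} 1≤k k≤d 1≤i′ i′≤d i′≢k with <-cmp (suc i) k
... | tri< i′<k _ _     = suc i , 1≤i′ , <⇒≤∸1 (<-≤-trans i′<k k≤d) , skip-< i′<k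
... | tri≈ _ i′≡k _     = ⊥-elim (i′≢k i′≡k)
... | tri> _ _ (s≤s k≤i) = i , ≤-trans 1≤k k≤i , <⇒≤∸1 i′≤d , skip-≥ k≤i

sumTo-skip : ∀ d {k} (f : ℕ → ℕ) → 1 ≤ k → k ≤ d →
  sumTo (d ∸ 1) (λ i → f (skip k i)) + f k ≡ sumTo d f
sumTo-skip zero    f (s≤s _) ()
sumTo-skip (suc d) f 1≤k k≤1+d with m≤n⇒m<n∨m≡n k≤1+d
... | inj₂ refl = cong (_+ f (suc d)) (sumTo-cong d (λ i _ i≤d → cong f (skip-< (s≤s i≤d))))
sumTo-skip (suc zero) f (s≤s _) _ | inj₁ (s≤s ())
sumTo-skip (suc (suc d)) {k} f 1≤k _ | inj₁ (s≤s k≤1+d) = begin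
  S + f (skip k (suc d)) + f k  ≡⟨ cong (λ i → S + f i + f k) (skip-≥ k≤1+d) ⟩
  S + f (suc (suc d)) + f k     ≡⟨ xy∙z≈xz∙y S _ _ ⟩
  S + f k + f (suc (suc d))     ≡⟨ cong (_+ f (suc (suc d))) (sumTo-skip (suc d) f 1≤k k≤1+d) ⟩
  sumTo (suc d) f + f (suc (suc d)) ∎
  where
  open ≡-Reasoning
  S = sumTo d (λ i → f (skip k i))

UpperTriangular : Mat → Set
UpperTriangular A = ∀ i j → 1 ≤ j → j < i → i ≤ dim A → ent A i j ≡ 0

RowsNonzero : Mat → Set
RowsNonzero A = ∀ i → 1 ≤ i → i ≤ dim A → ∃[ j ] (1 ≤ j × j ≤ dim A × 0 < ent A i j)

ColumnsNonzero : Mat → Set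
ColumnsNonzero A = ∀ j → 1 ≤ j → j ≤ dim A → ∃[ i ] (1 ≤ i × i ≤ dim A × 0 < ent A i j)

rowSum : (ℕ → ℕ) → Mat → ℕ → ℕ
rowSum F A i = sumTo (dim A) (λ j → F (ent A i j))

-- total A and numPositive A are definitionally entrySum id A and entrySum pos A.
entrySum : (ℕ → ℕ) → Mat → ℕ
entrySum F A = sumTo (dim A) (rowSum F A)

upperTriangular-pos⇒≤ : ∀ {A} → UpperTriangular A → ∀ {i j} → 1 ≤ j → i ≤ dim A →
  0 < ent A i j → i ≤ j
upperTriangular-pos⇒≤ ut 1≤j i≤d pos = ≮⇒≥ (λ j<i → >⇒≢ pos (ut _ _ 1≤j j<i i≤d))

dim≤total : ∀ A → RowsNonzero A → dim A ≤ total A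
dim≤total A rows = d≤sumTo (dim A) _ λ i 1≤i i≤d →
  let (j , 1≤j , j≤d , pos) = rows i 1≤i i≤d in
  ≤-trans pos (term≤sumTo (dim A) (ent A i) 1≤j j≤d)

numPositive-dim1 : ∀ A → dim A ≡ 1 → numPositive A ≡ pos (total A)
numPositive-dim1 (mat _ e) refl = refl

entrySum-update : ∀ F A (e : ℕ → ℕ → ℕ) {p q} → 1 ≤ p → p ≤ dim A → 1 ≤ q → q ≤ dim A →
  (∀ {i j} → i ≢ p ⊎ j ≢ q → e i j ≡ ent A i j) →
  entrySum F (mat (dim A) e) + F (ent A p q) ≡ entrySum F A + F (e p q)
entrySum-update F A e {p} {q} 1≤p p≤d 1≤q q≤d e≗A = +-cancelʳ-≡ (R p) _ _ (begin
  ΣR′ + x + R p    ≡⟨ xy∙z≈xz∙y ΣR′ x _ ⟩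
  ΣR′ + R p + x    ≡⟨ cong (_+ x) otherRows ⟩
  ΣR + R′ p + x    ≡⟨ +-assoc ΣR _ x ⟩
  ΣR + (R′ p + x)  ≡⟨ cong (ΣR +_) rowP ⟩
  ΣR + (R p + y)   ≡⟨ x∙yz≈xz∙y ΣR _ y ⟩
  ΣR + y + R p     ∎)
  where
  open ≡-Reasoning
  d = dim A
  B = mat d e
  R = rowSum F A
  R′ = rowSum F B
  ΣR = entrySum F A
  ΣR′ = entrySum F B
  x = F (ent A p q)
  y = F (e p q)
  otherRows : ΣR′ + R p ≡ ΣR + R′ p
  otherRows = sumTo-update d R R′ 1≤p p≤d λ i _ _ i≢p →
    sumTo-cong d (λ j _ _ → cong F (e≗A (inj₁ i≢p)))
  rowP : R′ p + x ≡ R p + y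
  rowP = sumTo-update d (λ j → F (ent A p j)) (λ j → F (e p j)) 1≤q q≤d
    (λ j _ _ j≢q → cong F (e≗A (inj₂ j≢q)))

entrySum-dropLast : ∀ F d e → F 0 ≡ 0 →
  (∀ i → 1 ≤ i → i ≤ d → e i (suc d) ≡ 0) → (∀ j → 1 ≤ j → j ≤ d → e (suc d) j ≡ 0) →
  entrySum F (mat (suc d) e) ≡ entrySum F (mat d e) + F (e (suc d) (suc d))
entrySum-dropLast F d e F0 column0 row0 = cong₂ _+_
  (sumTo-cong d λ i 1≤i i≤d →
    trans (cong (λ x → rowSum F (mat d e) i + F x) (column0 i 1≤i i≤d))
          (trans (cong (rowSum F (mat d e) i +_) F0) (+-identityʳ _)))
  (cong (_+ F (e (suc d) (suc d)))
    (sumTo-zero d λ j 1≤j j≤d → trans (cong F (row0 j 1≤j j≤d)) F0))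

witness-belowLast : ∀ {d} {f : ℕ → ℕ} → f (suc d) ≡ 0 →
  ∃[ j ] (1 ≤ j × j ≤ suc d × 0 < f j) → ∃[ j ] (1 ≤ j × j ≤ d × 0 < f j)
witness-belowLast f[1+d]≡0 (j , 1≤j , j≤1+d , pos) with m≤n⇒m<n∨m≡n j≤1+d
... | inj₁ j<1+d = j , 1≤j , ≤-pred j<1+d , pos
... | inj₂ refl  = ⊥-elim (>⇒≢ pos f[1+d]≡0)

deleteAt : ℕ → Mat → Mat
deleteAt k M = mat (dim M ∸ 1) (λ i j → ent M (skip k i) (skip k j))

deleteAt-upperTriangular : ∀ k M → UpperTriangular M → UpperTriangular (deleteAt k M)
deleteAt-upperTriangular k M ut i j 1≤j j<i i≤d∸1 =
  ut (skip k i) (skip k j) (proj₁ (skip-inRange k (dim M) 1≤j (≤-trans (<⇒≤ j<i) i≤d∸1)))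
     (skip-<-mono k j<i) (proj₂ (skip-inRange k (dim M) (≤-trans 1≤j (<⇒≤ j<i)) i≤d∸1))

deleteAt-rowsNonzero : ∀ k M → 1 ≤ k → k ≤ dim M →
  (∀ i → 1 ≤ i → i ≤ dim M → i ≢ k → ∃[ j ] (1 ≤ j × j ≤ dim M × j ≢ k × 0 < ent M i j)) →
  RowsNonzero (deleteAt k M)
deleteAt-rowsNonzero k M 1≤k k≤d rows i 1≤i i≤d∸1 with skip-inRange k (dim M) 1≤i i≤d∸1
... | 1≤i′ , i′≤d with rows (skip k i) 1≤i′ i′≤d (skip-≢ k i)
... | j′ , 1≤j′ , j′≤d , j′≢k , pos with skip-surjective 1≤k k≤d 1≤j′ j′≤d j′≢k
... | j , 1≤j , j≤d∸1 , refl = j , 1≤j , j≤d∸1 , pos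

deleteAt-columnsNonzero : ∀ k M → 1 ≤ k → k ≤ dim M →
  (∀ j → 1 ≤ j → j ≤ dim M → j ≢ k → ∃[ i ] (1 ≤ i × i ≤ dim M × i ≢ k × 0 < ent M i j)) →
  ColumnsNonzero (deleteAt k M)
deleteAt-columnsNonzero k M 1≤k k≤d cols j 1≤j j≤d∸1 with skip-inRange k (dim M) 1≤j j≤d∸1
... | 1≤j′ , j′≤d with cols (skip k j) 1≤j′ j′≤d (skip-≢ k j)
... | i′ , 1≤i′ , i′≤d , i′≢k , pos with skip-surjective 1≤k k≤d 1≤i′ i′≤d i′≢k
... | i , 1≤i , i≤d∸1 , refl = i , 1≤i , i≤d∸1 , pos

-- rem3 A is definitionally deleteAt (index A) (columnCopied A).
columnCopied : Mat → Mat
columnCopied A = mat (dim A) (λ i j →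
  if (j ≡ᵇ dim A) ∧ (0 <ᵇ i) ∧ (i <ᵇ index A) then ent A i (index A) else ent A i j)

columnCopied-off : ∀ A {i j} → j ≢ dim A → ent (columnCopied A) i j ≡ ent A i j
columnCopied-off A j≢d rewrite ≢⇒≡ᵇ≡false j≢d = refl

columnCopied-low : ∀ A {i j} → index A ≤ i → ent (columnCopied A) i j ≡ ent A i j
columnCopied-low A {i} {j} k≤i
  rewrite ≥⇒<ᵇ≡false k≤i | ∧-zeroʳ (0 <ᵇ i) | ∧-zeroʳ (j ≡ᵇ dim A) = refl

columnCopied-copy : ∀ A {i} → 1 ≤ i → i < index A →
  ent (columnCopied A) i (dim A) ≡ ent A i (index A)
columnCopied-copy A 1≤i i<k
  rewrite ≡ᵇ-refl (dim A) | <⇒<ᵇ≡true 1≤i | <⇒<ᵇ≡true i<k = refl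

columnCopied-upperTriangular : ∀ A → UpperTriangular A → UpperTriangular (columnCopied A)
columnCopied-upperTriangular A ut i j 1≤j j<i i≤d =
  trans (columnCopied-off A (<⇒≢ (<-≤-trans j<i i≤d))) (ut i j 1≤j j<i i≤d)

-- The index of a matrix

firstPosFrom-≥ : ∀ g c i → i ≤ firstPosFrom g c i
firstPosFrom-≥ g zero    i = ≤-refl
firstPosFrom-≥ g (suc c) i with 0 <ᵇ g i
... | true  = ≤-refl
... | false = ≤-trans (n≤1+n i) (firstPosFrom-≥ g c (suc i))

firstPosFrom-spec : ∀ g c i {j} → i ≤ j → j < i + c → 0 < g j →
  firstPosFrom g c i ≤ j × 0 < g (firstPosFrom g c i)
firstPosFrom-spec g zero i {j} i≤j j<i+0 _ =
  ⊥-elim (<⇒≱ (subst (j <_) (+-identityʳ i) j<i+0) i≤j)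
firstPosFrom-spec g (suc c) i {j} i≤j j<i+1+c gj>0 with 0 <ᵇ g i in gi
... | true  = i≤j , <ᵇ≡true⇒< gi
... | false with m≤n⇒m<n∨m≡n i≤j
...   | inj₁ i<j  = firstPosFrom-spec g c (suc i) i<j (subst (j <_) (+-suc i c) j<i+1+c) gj>0
...   | inj₂ refl = ⊥-elim (<⇒≱ gj>0 (<ᵇ≡false⇒≥ gi))

1≤index : ∀ A → 1 ≤ index A
1≤index A = firstPosFrom-≥ _ (dim A) 1

index-≤ : ∀ A {i} → 1 ≤ i → i ≤ dim A → 0 < ent A i (dim A) → index A ≤ i
index-≤ A 1≤i i≤d pos = proj₁ (firstPosFrom-spec (λ i → ent A i (dim A)) (dim A) 1 1≤i (s≤s i≤d) pos)

val-pos : ∀ A {i} → 1 ≤ i → i ≤ dim A → 0 < ent A i (dim A) → 0 < val A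
val-pos A 1≤i i≤d pos = proj₂ (firstPosFrom-spec (λ i → ent A i (dim A)) (dim A) 1 1≤i (s≤s i≤d) pos)

aboveIndex-zero : ∀ A {i j} → 1 ≤ i → i ≤ dim A → 0 < ent A i (dim A) →
  1 ≤ j → j < index A → ent A j (dim A) ≡ 0
aboveIndex-zero A {i} {j} 1≤i i≤d pos 1≤j j<k with ent A j (dim A) in eq
... | zero  = refl
... | suc _ = ⊥-elim (<⇒≱ j<k (index-≤ A 1≤j j≤d (subst (0 <_) (sym eq) z<s)))
  where
  j≤d : j ≤ dim A
  j≤d = ≤-trans (<⇒≤ j<k) (≤-trans (index-≤ A 1≤i i≤d pos) i≤d)

1≤dim : ∀ {m} A → total A ≡ suc m → 1 ≤ dim A
1≤dim (mat (suc _) _) _ = s≤s z≤n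

module IsIntProperties {m A} (h : IsInt (suc m) A) where

  upperTriangular : UpperTriangular A
  upperTriangular = proj₁ h

  total≡ : total A ≡ suc m
  total≡ = proj₁ (proj₂ h)

  rowsNonzero : RowsNonzero A
  rowsNonzero = proj₁ (proj₂ (proj₂ h))

  columnsNonzero : ColumnsNonzero A
  columnsNonzero = proj₂ (proj₂ (proj₂ h))

  1≤d : 1 ≤ dim A
  1≤d = 1≤dim A total≡

  lastDiagonal-pos : 0 < ent A (dim A) (dim A)
  lastDiagonal-pos with rowsNonzero (dim A) 1≤d ≤-refl
  ... | j , 1≤j , j≤d , pos with m≤n⇒m<n∨m≡n j≤d
  ...   | inj₂ refl = pos
  ...   | inj₁ j<d  = ⊥-elim (>⇒≢ pos (upperTriangular (dim A) j 1≤j j<d ≤-refl))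

  index≤dim : index A ≤ dim A
  index≤dim = index-≤ A 1≤d ≤-refl lastDiagonal-pos

  val>0 : 0 < val A
  val>0 = val-pos A 1≤d ≤-refl lastDiagonal-pos

  lastColumn-zero : ∀ {j} → 1 ≤ j → j < index A → ent A j (dim A) ≡ 0
  lastColumn-zero = aboveIndex-zero A 1≤d ≤-refl lastDiagonal-pos

-- The removal operations

data RemovalStep (A B : Mat) : Set where
  sameIndex : index B ≡ index A → numPositive B ≡ numPositive A → RemovalStep A B
  newIndex  : index B ≢ index A → suc (numPositive B) ≡ numPositive A → RemovalStep A B

rem1-other : ∀ A {i j} → i ≢ index A ⊎ j ≢ dim A → ent (rem1 A) i j ≡ ent A i j
rem1-other A (inj₁ i≢k) rewrite ≢⇒≡ᵇ≡false i≢k = refl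
rem1-other A {i} (inj₂ j≢d) rewrite ≢⇒≡ᵇ≡false j≢d | ∧-zeroʳ (i ≡ᵇ index A) = refl

rem1-at : ∀ A → ent (rem1 A) (index A) (dim A) ≡ val A ∸ 1
rem1-at A rewrite ≡ᵇ-refl (index A) | ≡ᵇ-refl (dim A) = refl

rem1-pos : ∀ A {i j} → 0 < ent A i j → (i ≢ index A ⊎ j ≢ dim A) ⊎ 2 ≤ val A →
  0 < ent (rem1 A) i j
rem1-pos A pos (inj₁ off) = subst (0 <_) (sym (rem1-other A off)) pos
rem1-pos A {i} {j} pos (inj₂ 2≤v) with i ≟ index A | j ≟ dim A
... | no i≢k   | _        = rem1-pos A pos (inj₁ (inj₁ i≢k))
... | yes _    | no j≢d   = rem1-pos A pos (inj₁ (inj₂ j≢d))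
... | yes refl | yes refl = subst (0 <_) (sym (rem1-at A)) (∸-monoˡ-≤ 1 2≤v)

atCorner? : ∀ A i j → (i ≡ index A × j ≡ dim A) ⊎ (i ≢ index A ⊎ j ≢ dim A)
atCorner? A i j with i ≟ index A | j ≟ dim A
... | yes i≡k | yes j≡d = inj₁ (i≡k , j≡d)
... | no i≢k  | _       = inj₂ (inj₁ i≢k)
... | yes _   | no j≢d  = inj₂ (inj₂ j≢d)

-- The cases in which removal uses Rem1; they keep row index A and column dim A
-- nonzero after the decrement.
Rem1Admissible : Mat → Set
Rem1Admissible A =
  2 ≤ val A ⊎ (index A < dim A × ∃[ j ] (1 ≤ j × j < dim A × 0 < ent A (index A) j))

module Rem1 {m A} (h : IsInt (suc (suc m)) A) where
  open IsIntProperties h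

  entrySum-rem1 : ∀ F → entrySum F (rem1 A) + F (val A) ≡ entrySum F A + F (val A ∸ 1)
  entrySum-rem1 F =
    trans (entrySum-update F A _ (1≤index A) index≤dim 1≤d ≤-refl (rem1-other A))
          (cong (λ v → entrySum F A + F v) (rem1-at A))

  rem1-upperTriangular : UpperTriangular (rem1 A)
  rem1-upperTriangular i j 1≤j j<i i≤d =
    trans (rem1-other A (inj₂ (<⇒≢ (<-≤-trans j<i i≤d)))) (upperTriangular i j 1≤j j<i i≤d)

  rem1-total : total (rem1 A) ≡ suc m
  rem1-total = suc-injective (trans (x+v≡y+[v∸1]⇒1+x≡y val>0 (entrySum-rem1 id)) total≡)

  rem1-rowsNonzero : Rem1Admissible A → RowsNonzero (rem1 A)
  rem1-rowsNonzero adm i 1≤i i≤d with rowsNonzero i 1≤i i≤d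
  ... | j , 1≤j , j≤d , pos with atCorner? A i j | adm
  ... | inj₂ off | _ = j , 1≤j , j≤d , rem1-pos A pos (inj₁ off)
  ... | inj₁ _ | inj₁ 2≤v = j , 1≤j , j≤d , rem1-pos A pos (inj₂ 2≤v)
  ... | inj₁ (refl , _) | inj₂ (_ , j′ , 1≤j′ , j′<d , pos′) =
    j′ , 1≤j′ , <⇒≤ j′<d , rem1-pos A pos′ (inj₁ (inj₂ (<⇒≢ j′<d)))

  rem1-columnsNonzero : Rem1Admissible A → ColumnsNonzero (rem1 A)
  rem1-columnsNonzero adm j 1≤j j≤d with columnsNonzero j 1≤j j≤d
  ... | i , 1≤i , i≤d , pos with atCorner? A i j | adm
  ... | inj₂ off | _ = i , 1≤i , i≤d , rem1-pos A pos (inj₁ off)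
  ... | inj₁ _ | inj₁ 2≤v = i , 1≤i , i≤d , rem1-pos A pos (inj₂ 2≤v)
  ... | inj₁ (_ , refl) | inj₂ (k<d , _) =
    dim A , 1≤d , ≤-refl , rem1-pos A lastDiagonal-pos (inj₁ (inj₁ (>⇒≢ k<d)))

  rem1-isInt : Rem1Admissible A → IsInt (suc m) (rem1 A)
  rem1-isInt adm = rem1-upperTriangular , rem1-total , rem1-rowsNonzero adm , rem1-columnsNonzero adm

  rem1-large : 2 ≤ val A → IsInt (suc m) (rem1 A) × RemovalStep A (rem1 A)
  rem1-large 2≤v = rem1-isInt (inj₁ 2≤v) , sameIndex index-eq numPositive-eq
    where
    open ≡-Reasoning
    B = rem1 A
    corner>0 : 0 < ent B (index A) (dim A)
    corner>0 = rem1-pos A val>0 (inj₂ 2≤v)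

    index-eq : index B ≡ index A
    index-eq = ≤-antisym (index-≤ B (1≤index A) index≤dim corner>0) (≮⇒≥ λ iB<k →
      >⇒≢ (val-pos B (1≤index A) index≤dim corner>0)
          (trans (rem1-other A (inj₁ (<⇒≢ iB<k))) (lastColumn-zero (1≤index B) iB<k)))

    numPositive-eq : numPositive B ≡ numPositive A
    numPositive-eq = +-cancelʳ-≡ 1 _ _ (begin
      numPositive B + 1            ≡⟨ cong (numPositive B +_) (sym (pos-positive val>0)) ⟩
      numPositive B + pos (val A)  ≡⟨ entrySum-rem1 pos ⟩
      numPositive A + pos (val A ∸ 1) ≡⟨ cong (numPositive A +_) (pos-positive (∸-monoˡ-≤ 1 2≤v)) ⟩
      numPositive A + 1            ∎)

  rem1-unit : val A ≡ 1 → index A < dim A → 0 < otherPosInRow A →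
    IsInt (suc m) (rem1 A) × RemovalStep A (rem1 A)
  rem1-unit v≡1 k<d rest>0 = hB , newIndex index≢ numPositive-eq
    where
    open ≡-Reasoning
    B = rem1 A
    hB : IsInt (suc m) B
    hB with ∃-positive-term (dim A ∸ 1) _ rest>0
    ... | j , 1≤j , j≤d∸1 , pos =
      rem1-isInt (inj₂ (k<d , j , 1≤j , ≤∸1⇒< (dim A) 1≤j j≤d∸1 , pos>0⇒>0 pos))

    index≢ : index B ≢ index A
    index≢ eq = >⇒≢ (IsIntProperties.val>0 hB)
      (trans (cong (λ i → ent B i (dim A)) eq) (trans (rem1-at A) (cong (_∸ 1) v≡1)))

    numPositive-eq : suc (numPositive B) ≡ numPositive A
    numPositive-eq = begin
      suc (numPositive B)              ≡⟨ +-comm 1 _ ⟩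
      numPositive B + 1                ≡⟨ cong (λ v → numPositive B + pos v) (sym v≡1) ⟩
      numPositive B + pos (val A)      ≡⟨ entrySum-rem1 pos ⟩
      numPositive A + pos (val A ∸ 1)  ≡⟨ cong (λ v → numPositive A + pos (v ∸ 1)) v≡1 ⟩
      numPositive A + 0                ≡⟨ +-identityʳ _ ⟩
      numPositive A                    ∎

rem2-step : ∀ {m A} → IsInt (suc (suc m)) A → val A ≡ 1 → index A ≡ dim A →
  IsInt (suc m) (rem2 A) × RemovalStep A (rem2 A)
rem2-step {A = mat zero _} (_ , () , _) _ _
rem2-step {m} {A@(mat (suc d) e)} h v≡1 k≡d =
  hB , newIndex index≢ (trans (+-comm 1 _) (sym (entrySum-rem2 pos refl)))
  where
  open IsIntProperties h
  B = rem2 A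
  aboveCorner-zero : ∀ i → 1 ≤ i → i ≤ d → e i (suc d) ≡ 0
  aboveCorner-zero i 1≤i i≤d = lastColumn-zero 1≤i (subst (i <_) (sym k≡d) (s≤s i≤d))
  leftOfCorner-zero : ∀ j → 1 ≤ j → j ≤ d → e (suc d) j ≡ 0
  leftOfCorner-zero j 1≤j j≤d = upperTriangular (suc d) j 1≤j (s≤s j≤d) ≤-refl
  entrySum-rem2 : ∀ F → F 0 ≡ 0 → entrySum F A ≡ entrySum F B + F 1
  entrySum-rem2 F F0 = trans (entrySum-dropLast F d e F0 aboveCorner-zero leftOfCorner-zero)
    (cong (λ x → entrySum F B + F x) (trans (cong (λ i → e i (suc d)) (sym k≡d)) v≡1))
  hB : IsInt (suc m) B
  hB = (λ i j 1≤j j<i i≤d → upperTriangular i j 1≤j j<i (m≤n⇒m≤1+n i≤d))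
     , +-cancelʳ-≡ 1 _ _ (trans (sym (entrySum-rem2 id refl)) (trans total≡ (+-comm 1 (suc m))))
     , (λ i 1≤i i≤d → witness-belowLast (aboveCorner-zero i 1≤i i≤d)
                                        (rowsNonzero i 1≤i (m≤n⇒m≤1+n i≤d)))
     , (λ j 1≤j j≤d → witness-belowLast (leftOfCorner-zero j 1≤j j≤d)
                                        (columnsNonzero j 1≤j (m≤n⇒m≤1+n j≤d)))
  index≢ : index B ≢ index A
  index≢ eq = n≮n (suc d) (subst (_< suc d) (trans eq k≡d) (s≤s (IsIntProperties.index≤dim hB)))

module Rem3 {m A} (h : IsInt (suc (suc m)) A) (v≡1 : val A ≡ 1) (k<d : index A < dim A)
            (rest≡0 : otherPosInRow A ≡ 0) where
  open IsIntProperties h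
  open ≡-Reasoning
  private
    k = index A
    d = dim A
    C = columnCopied A
    1≤k : 1 ≤ k
    1≤k = 1≤index A
    k≤d : k ≤ d
    k≤d = index≤dim

  rowIndex-zero : ∀ {j} → 1 ≤ j → j < d → ent A k j ≡ 0
  rowIndex-zero 1≤j j<d = pos≡0⇒≡0 (sumTo≡0⇒term≡0 (d ∸ 1) _ rest≡0 1≤j (<⇒≤∸1 j<d))

  ∃aboveIndex : ∃[ i ] (1 ≤ i × i < k × 0 < ent A i k)
  ∃aboveIndex with columnsNonzero k 1≤k k≤d
  ... | i , 1≤i , i≤d , pos with <-cmp i k
  ... | tri< i<k _ _ = i , 1≤i , i<k , pos
  ... | tri≈ _ refl _ = ⊥-elim (>⇒≢ pos (rowIndex-zero 1≤k k<d))
  ... | tri> _ _ k<i = ⊥-elim (>⇒≢ pos (upperTriangular i k 1≤k k<i i≤d))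

  rowSum-index : ∀ F → F 0 ≡ 0 → rowSum F A k ≡ F 1
  rowSum-index F F0 = trans
    (sumTo-single d _ 1≤d ≤-refl λ j 1≤j j≤d j≢d → trans (cong F (rowIndex-zero 1≤j (≤∧≢⇒< j≤d j≢d))) F0)
    (cong F v≡1)

  rowSum-deleted-below : ∀ F → F 0 ≡ 0 → ∀ {i} → k < i → i ≤ d →
    sumTo (d ∸ 1) (λ j → F (ent C i (skip k j))) ≡ rowSum F A i
  rowSum-deleted-below F F0 {i} k<i i≤d = begin
    sumTo (d ∸ 1) (λ j → F (ent C i (skip k j)))
      ≡⟨ sumTo-cong (d ∸ 1) (λ j _ _ → cong F (columnCopied-low A (<⇒≤ k<i))) ⟩
    S                  ≡⟨ sym (+-identityʳ S) ⟩
    S + 0              ≡⟨ cong (S +_) (sym F[A[i,k]]≡0) ⟩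
    S + F (ent A i k)  ≡⟨ sumTo-skip d (λ j → F (ent A i j)) 1≤k k≤d ⟩
    rowSum F A i       ∎
    where
    S = sumTo (d ∸ 1) (λ j → F (ent A i (skip k j)))
    F[A[i,k]]≡0 : F (ent A i k) ≡ 0
    F[A[i,k]]≡0 = trans (cong F (upperTriangular i k 1≤k k<i i≤d)) F0

  rowSum-deleted-above : ∀ F → F 0 ≡ 0 → ∀ {i} → 1 ≤ i → i < k →
    sumTo (d ∸ 1) (λ j → F (ent C i (skip k j))) ≡ rowSum F A i
  rowSum-deleted-above F F0 {i} 1≤i i<k = +-cancelʳ-≡ (F (ent A i k)) _ _ (begin
    S + F (ent A i k)             ≡⟨ cong (λ x → S + F x) (sym (columnCopied-off A (<⇒≢ k<d))) ⟩
    S + F (ent C i k)             ≡⟨ sumTo-skip d (λ j → F (ent C i j)) 1≤k k≤d ⟩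
    rowSum F C i                  ≡⟨ sym (+-identityʳ _) ⟩
    rowSum F C i + 0              ≡⟨ cong (rowSum F C i +_) (sym F[A[i,d]]≡0) ⟩
    rowSum F C i + F (ent A i d)  ≡⟨ sumTo-update d _ _ 1≤d ≤-refl C≗A ⟩
    rowSum F A i + F (ent C i d)  ≡⟨ cong (λ x → rowSum F A i + F x) (columnCopied-copy A 1≤i i<k) ⟩
    rowSum F A i + F (ent A i k)  ∎)
    where
    S = sumTo (d ∸ 1) (λ j → F (ent C i (skip k j)))
    F[A[i,d]]≡0 : F (ent A i d) ≡ 0
    F[A[i,d]]≡0 = trans (cong F (lastColumn-zero 1≤i i<k)) F0
    C≗A : ∀ j → 1 ≤ j → j ≤ d → j ≢ d → F (ent C i j) ≡ F (ent A i j)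
    C≗A j _ _ j≢d = cong F (columnCopied-off A j≢d)

  rowSum-deleted : ∀ F → F 0 ≡ 0 → ∀ {i} → 1 ≤ i → i ≤ d → i ≢ k →
    sumTo (d ∸ 1) (λ j → F (ent C i (skip k j))) ≡ rowSum F A i
  rowSum-deleted F F0 {i} 1≤i i≤d i≢k with <-cmp i k
  ... | tri< i<k _ _ = rowSum-deleted-above F F0 1≤i i<k
  ... | tri≈ _ i≡k _ = ⊥-elim (i≢k i≡k)
  ... | tri> _ _ k<i = rowSum-deleted-below F F0 k<i i≤d

  entrySum-rem3 : ∀ F → F 0 ≡ 0 → entrySum F (rem3 A) + F 1 ≡ entrySum F A
  entrySum-rem3 F F0 = begin
    entrySum F (rem3 A) + F 1
      ≡⟨ cong₂ _+_ (sumTo-cong (d ∸ 1) λ i 1≤i i≤d∸1 →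
           let (1≤i′ , i′≤d) = skip-inRange k d 1≤i i≤d∸1 in
           rowSum-deleted F F0 1≤i′ i′≤d (skip-≢ k i))
         (sym (rowSum-index F F0)) ⟩
    sumTo (d ∸ 1) (λ i → rowSum F A (skip k i)) + rowSum F A k
      ≡⟨ sumTo-skip d (rowSum F A) 1≤k k≤d ⟩
    entrySum F A ∎

  rowsOffIndex : ∀ i → 1 ≤ i → i ≤ d → i ≢ k → ∃[ j ] (1 ≤ j × j ≤ d × j ≢ k × 0 < ent C i j)
  rowsOffIndex i 1≤i i≤d i≢k with rowsNonzero i 1≤i i≤d
  ... | j , 1≤j , j≤d , pos with j ≟ k
  ... | yes refl = d , 1≤d , ≤-refl , >⇒≢ k<d , subst (0 <_) (sym (columnCopied-copy A 1≤i i<k)) pos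
    where
    i<k : i < k
    i<k = ≤∧≢⇒< (upperTriangular-pos⇒≤ upperTriangular 1≤k i≤d pos) i≢k
  ... | no j≢k = j , 1≤j , j≤d , j≢k , subst (0 <_) (sym C≡A) pos
    where
    C≡A : ent C i j ≡ ent A i j
    C≡A with j ≟ d
    ... | no j≢d = columnCopied-off A j≢d
    ... | yes refl = columnCopied-low A (≮⇒≥ λ i<k → >⇒≢ pos (lastColumn-zero 1≤i i<k))

  columnsOffIndex : ∀ j → 1 ≤ j → j ≤ d → j ≢ k → ∃[ i ] (1 ≤ i × i ≤ d × i ≢ k × 0 < ent C i j)
  columnsOffIndex j 1≤j j≤d j≢k with j ≟ d
  ... | yes refl = let (i , 1≤i , i<k , pos) = ∃aboveIndex in
    i , 1≤i , ≤-trans (<⇒≤ i<k) k≤d , <⇒≢ i<k , subst (0 <_) (sym (columnCopied-copy A 1≤i i<k)) pos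
  ... | no j≢d with columnsNonzero j 1≤j j≤d
  ... | i , 1≤i , i≤d , pos = i , 1≤i , i≤d , i≢k , subst (0 <_) (sym (columnCopied-off A j≢d)) pos
    where
    i≢k : i ≢ k
    i≢k refl = >⇒≢ pos (rowIndex-zero 1≤j (≤∧≢⇒< j≤d j≢d))

  rem3-isInt : IsInt (suc m) (rem3 A)
  rem3-isInt = deleteAt-upperTriangular k C (columnCopied-upperTriangular A upperTriangular)
             , suc-injective (trans (+-comm 1 _) (trans (entrySum-rem3 id refl) total≡))
             , deleteAt-rowsNonzero k C 1≤k k≤d rowsOffIndex
             , deleteAt-columnsNonzero k C 1≤k k≤d columnsOffIndex

  copiedEntry : ∀ {i} → 1 ≤ i → i < k → ent (rem3 A) i (d ∸ 1) ≡ ent A i k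
  copiedEntry {i} 1≤i i<k = begin
    ent C (skip k i) (skip k (d ∸ 1))
      ≡⟨ cong₂ (ent C) (skip-< i<k) (trans (skip-≥ (<⇒≤∸1 k<d)) (suc[d∸1]≡d 1≤d)) ⟩
    ent C i d  ≡⟨ columnCopied-copy A 1≤i i<k ⟩
    ent A i k  ∎

  index-rem3< : index (rem3 A) < k
  index-rem3< = let (i , 1≤i , i<k , pos) = ∃aboveIndex in
    ≤-<-trans (index-≤ (rem3 A) 1≤i (<⇒≤∸1 (<-trans i<k k<d))
                       (subst (0 <_) (sym (copiedEntry 1≤i i<k)) pos))
              i<k

  rem3-step : IsInt (suc m) (rem3 A) × RemovalStep A (rem3 A)
  rem3-step = rem3-isInt , newIndex (<⇒≢ index-rem3<) (trans (+-comm 1 _) (entrySum-rem3 pos refl))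

removal-step : ∀ {m A} → IsInt (suc (suc m)) A →
  IsInt (suc m) (removal A) × RemovalStep A (removal A)
removal-step {m} {A} h with val A in v
... | zero        = ⊥-elim (>⇒≢ (IsIntProperties.val>0 h) v)
... | suc (suc _) = Rem1.rem1-large h (subst (2 ≤_) (sym v) (s≤s (s≤s z≤n)))
... | suc zero with index A <ᵇ dim A in k<d
...   | false = rem2-step h v (≤-antisym (IsIntProperties.index≤dim h) (<ᵇ≡false⇒≥ k<d))
...   | true with 0 <ᵇ otherPosInRow A in rest
...     | true  = Rem1.rem1-unit h v (<ᵇ≡true⇒< k<d) (<ᵇ≡true⇒< rest)
...     | false = Rem3.rem3-step h v (<ᵇ≡true⇒< k<d) (n≤0⇒n≡0 (<ᵇ≡false⇒≥ rest))

-- Γ and adjacent equalities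

adjEq-snoc : ∀ ys y z →
  adjEq ((ys ++ y ∷ []) ++ z ∷ []) ≡ adjEq (ys ++ y ∷ []) + (if y ≡ᵇ z then 1 else 0)
adjEq-snoc []            y z = +-identityʳ _
adjEq-snoc (x ∷ [])      y z = trans (cong ((if x ≡ᵇ y then 1 else 0) +_) (adjEq-snoc [] y z))
  (sym (+-assoc (if x ≡ᵇ y then 1 else 0) _ _))
adjEq-snoc (x ∷ x′ ∷ ys) y z = trans (cong ((if x ≡ᵇ x′ then 1 else 0) +_) (adjEq-snoc (x′ ∷ ys) y z))
  (sym (+-assoc (if x ≡ᵇ x′ then 1 else 0) _ _))

Γ-lastIndex : ∀ m B → IsInt (suc m) B → ∃[ ys ] (Γ (suc m) B ≡ ys ++ (index B ∸ 1) ∷ [])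
Γ-lastIndex zero    B h = [] , cong (_∷ []) (sym (m≤n⇒m∸n≡0 index≤1))
  where
  open IsIntProperties h
  index≤1 : index B ≤ 1
  index≤1 = ≤-trans index≤dim (≤-trans (dim≤total B rowsNonzero) (≤-reflexive total≡))
Γ-lastIndex (suc m) B h = Γ (suc m) (removal B) , refl

step-balance : ∀ {A B} → RemovalStep A B → 1 ≤ index A → 1 ≤ index B → ∀ a →
  numPositive A + (a + (if index B ∸ 1 ≡ᵇ index A ∸ 1 then 1 else 0)) ≡ suc (numPositive B + a)
step-balance {A} {B} (sameIndex index≡ np≡) _ _ a
  rewrite index≡ | ≡ᵇ-refl (index A ∸ 1) | sym np≡ =
  trans (sym (+-assoc (numPositive B) a 1)) (+-comm _ 1)
step-balance {A} {B} (newIndex index≢ np≡) 1≤kA 1≤kB a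
  rewrite ≢⇒≡ᵇ≡false (λ eq → index≢ (∸1-injective 1≤kB 1≤kA eq)) | +-identityʳ a | sym np≡ = refl

numPositive+adjEq : ∀ m A → IsInt (suc m) A → numPositive A + adjEq (Γ (suc m) A) ≡ suc m
numPositive+adjEq zero A h = trans (+-identityʳ _) (trans (numPositive-dim1 A dim≡1) (cong pos total≡))
  where
  open IsIntProperties h
  dim≡1 : dim A ≡ 1
  dim≡1 = ≤-antisym (≤-trans (dim≤total A rowsNonzero) (≤-reflexive total≡)) 1≤d
numPositive+adjEq (suc m) A h with removal-step h
... | hB , step with Γ-lastIndex m (removal A) hB
... | ys , Γ≡ = begin
  numPositive A + adjEq (Γ (suc m) B ++ kA ∷ [])
    ≡⟨ cong (λ xs → numPositive A + adjEq (xs ++ kA ∷ [])) Γ≡ ⟩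
  numPositive A + adjEq ((ys ++ kB ∷ []) ++ kA ∷ [])
    ≡⟨ cong (numPositive A +_) (adjEq-snoc ys kB kA) ⟩
  numPositive A + (adjEq (ys ++ kB ∷ []) + _)
    ≡⟨ step-balance step (1≤index A) (1≤index B) _ ⟩
  suc (numPositive B + adjEq (ys ++ kB ∷ []))
    ≡⟨ cong (λ xs → suc (numPositive B + adjEq xs)) (sym Γ≡) ⟩
  suc (numPositive B + adjEq (Γ (suc m) B))
    ≡⟨ cong suc (numPositive+adjEq m B hB) ⟩
  suc (suc m) ∎
  where
  open ≡-Reasoning
  B = removal A
  kA = index A ∸ 1
  kB = index B ∸ 1

mainTheorem7 : (n : ℕ) → 1 ≤ n → (A : Mat) → IsInt n A →
    numPositive A ≡ n ∸ adjEq (Γ n A)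
mainTheorem7 zero    () _ _
mainTheorem7 (suc m) _ A h = begin
  numPositive A                        ≡⟨ sym (m+n∸n≡m _ (adjEq (Γ (suc m) A))) ⟩
  numPositive A + adjEq (Γ (suc m) A) ∸ adjEq (Γ (suc m) A)
                                       ≡⟨ cong (_∸ adjEq (Γ (suc m) A)) (numPositive+adjEq m A h) ⟩
  suc m ∸ adjEq (Γ (suc m) A)          ∎
  where open ≡-Reasoning
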